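{- Let $d\ge3$, $\mathcal A=\{0,\dots,d-1\}$, $\varphi$ the morphism $\varphi(i)=0(i+1)$ ($0\le i\le d-2$), $\varphi(d-1)=0(d-1)(d-1)$, and $\mathbf u$ its fixed point. Let $i,j,k,l\in\mathcal A$ be such that $i\ne j$, $k\ne l$, and $\max\{i,j\}\le\min\{k,l\}$. Then there is no word $w\in\mathcal A^*$ such that both $iwk$ and $jwl$ belong to $\mathcal L(\mathbf u)$.
   Context: $\mathbf u$ is the unique infinite word starting with $0$ with $\varphi(\mathbf u)=\mathbf u$, and $\mathcal L(\mathbf u)$ is the set of its finite factors (including the empty word). -}

module Defs where

open import Data.Nat using (ℕ; zero; suc; _+_; _<?_; s≤s)
open import Data.Fin using (Fin; zero; suc; toℕ; fromℕ<)
open import Data.List using (List; []; _∷_; concatMap; length)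
open import Data.Maybe using (Maybe; just; nothing)
open import Data.Product using (∃)
open import Relation.Binary.PropositionalEquality using (_≡_)
open import Relation.Nullary using (yes; no)

-- Throughout, the alphabet is A = {0,…,d-1} with d = suc n, i.e. Fin (suc n).
Letter : ℕ → Set
Letter n = Fin (suc n)

Word : ℕ → Set
Word n = List (Letter n)

φ : (n : ℕ) → Letter n → Word n
φ n i with toℕ i <? n
... | yes p = zero ∷ fromℕ< (s≤s p) ∷ []
... | no  _ = zero ∷ i ∷ i ∷ []

φ* : (n : ℕ) → Word n → Word n
φ* n = concatMap (φ n)

iterate : (n : ℕ) → ℕ → Word n
iterate n zero    = zero ∷ []
iterate n (suc m) = φ* n (iterate n m)

nth : ∀ {n} → Word n → ℕ → Letter n
nth []       _       = zero
nth (a ∷ _)  zero    = a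
nth (_ ∷ as) (suc k) = nth as k

-- The fixed point u = lim φ^m(0).  Since φ(0) = 01 and φ^m(0) is a prefix of
-- φ^(m+1)(0) with |φ^m(0)| ≥ m+1, the letter u_p equals the p-th letter of
-- φ^(p+1)(0) (so the default of nth is never used).
u : (n : ℕ) → ℕ → Letter n
u n p = nth (iterate n (suc p)) p

factorAt : (n : ℕ) → ℕ → ℕ → Word n
factorAt n p zero    = []
factorAt n p (suc k) = u n p ∷ factorAt n (suc p) k

InLang : (n : ℕ) → Word n → Set
InLang n w = ∃ λ p → factorAt n p (length w) ≡ w

-- Every two-letter factor of u is 0b with b ≠ 0, a0 with a ≠ 0, or (d-1)(d-1).  Consequently,
-- in a pair of factors iwk, jwl with w as short as possible, i and j are nonzero letters below
-- d-1, k and l are nonzero, and w is nonempty and ends with 0.  A 0 always starts a φ-block and a letter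
-- 0 < a < d-1 only occurs as the second letter of φ(a-1), so desubstituting both factors yields
-- i′vk′ and j′vl′ with φ(v)0 = w, i = i′+1, j = j′+1, k ≤ k′+1, l ≤ l′+1 (the same v on both
-- sides since φ is injective).  This is a shorter pair of the same kind.
module Submission where

open import Defs
open import Data.Empty using (⊥-elim)
open import Data.Fin using (toℕ; fromℕ<)
open import Data.Fin.Patterns using (0F)
open import Data.Fin.Properties using (toℕ-fromℕ<; toℕ≤pred[n]; toℕ-injective)
open import Data.List using (List; []; _∷_; _++_; _∷ʳ_; concatMap; length; take; drop; initLast; _∷ʳ′_)
open import Data.List.Properties
  using (++-assoc; ++-identityʳ; ∷-injective; ∷-injectiveˡ; ∷-injectiveʳ; ∷ʳ-++; concatMap-++; length-++; take++drop≡id)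
open import Data.List.Relation.Unary.Linked using (Linked; []; [-]; _∷_)
  renaming (head to Linked-head; tail to Linked-tail)
open import Data.Nat using (ℕ; zero; suc; _+_; _≤_; _<_; _⊔_; _⊓_; _<?_; s≤s; z≤n; s≤s⁻¹)
open import Data.Nat.Induction using (<-wellFounded)
open import Data.Nat.Properties
open import Data.Product using (∃; ∃₂; _×_; _,_; proj₂)
open import Data.Sum using (_⊎_; inj₁; inj₂)
open import Function using (_∘_)
open import Induction.WellFounded using (Acc; acc)
open import Level using (Level) renaming (_⊔_ to _⊔ˡ_)
open import Relation.Binary.Core using (Rel)
open import Relation.Binary.PropositionalEquality
open import Relation.Nullary using (¬_; yes; no)

private
  variable
    a ℓ : Level
    A : Set a

++-split-at-∷ : ∀ (xs pre : List A) {ys x s} → xs ++ ys ≡ pre ++ x ∷ s →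
  (∃ λ r → xs ≡ pre ++ x ∷ r × s ≡ r ++ ys) ⊎ (∃ λ q → pre ≡ xs ++ q × ys ≡ q ++ x ∷ s)
++-split-at-∷ []       pre       e = inj₂ (pre , refl , e)
++-split-at-∷ (y ∷ xs) []        e with refl , s≡ ← ∷-injective e = inj₁ (xs , refl , sym s≡)
++-split-at-∷ (y ∷ xs) (p ∷ pre) e with refl , e′ ← ∷-injective e with ++-split-at-∷ xs pre e′
... | inj₁ (r , xs≡ , s≡)   = inj₁ (r , cong (y ∷_) xs≡ , s≡)
... | inj₂ (q , pre≡ , ys≡) = inj₂ (q , cong (y ∷_) pre≡ , ys≡)

module _ {a b} {A : Set a} {B : Set b} (f : A → List B) where

  record Located (ys : List A) (pre : List B) (x : B) (s : List B) : Set (a ⊔ˡ b) where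
    constructor located
    field
      before after : List A
      block        : A
      q r          : List B
      ys≡          : ys ≡ before ++ block ∷ after
      pre≡         : pre ≡ concatMap f before ++ q
      block≡       : f block ≡ q ++ x ∷ r
      s≡           : s ≡ r ++ concatMap f after

  concatMap-locate : ∀ ys {pre x s} → concatMap f ys ≡ pre ++ x ∷ s → Located ys pre x s
  concatMap-locate []       {[]}    ()
  concatMap-locate []       {_ ∷ _} ()
  concatMap-locate (c ∷ ys) {pre} {x} {s} e with ++-split-at-∷ (f c) pre e
  ... | inj₁ (r , fc≡ , s≡) = record
    { before = [] ; after = ys ; block = c ; q = pre ; r = r
    ; ys≡ = refl ; pre≡ = refl ; block≡ = fc≡ ; s≡ = s≡ }
  ... | inj₂ (q , pre≡fc++q , rest≡) = shift (concatMap-locate ys rest≡)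
    where
    shift : Located ys q x s → Located (c ∷ ys) pre x s
    shift L = record
      { before = c ∷ L.before ; after = L.after ; block = L.block ; q = L.q ; r = L.r
      ; ys≡    = cong (c ∷_) L.ys≡
      ; pre≡   = trans pre≡fc++q (trans (cong (f c ++_) L.pre≡) (sym (++-assoc (f c) _ L.q)))
      ; block≡ = L.block≡
      ; s≡     = L.s≡
      }
      where module L = Located L

module _ {R : Rel A ℓ} where

  Linked-++⁻ˡ : ∀ xs {ys} → Linked R (xs ++ ys) → Linked R xs
  Linked-++⁻ˡ []           _           = []
  Linked-++⁻ˡ (x ∷ [])     _           = [-]
  Linked-++⁻ˡ (x ∷ y ∷ xs) (Rxy ∷ Rxs) = Rxy ∷ Linked-++⁻ˡ (y ∷ xs) Rxs

  Linked-++⁻ʳ : ∀ xs {ys} → Linked R (xs ++ ys) → Linked R ys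
  Linked-++⁻ʳ []       Rys   = Rys
  Linked-++⁻ʳ (x ∷ xs) Rxsys = Linked-++⁻ʳ xs (Linked-tail Rxsys)

module _ (n : ℕ) (0<n : 0 < n) where

  data φ-View (c : Letter n) : Word n → Set where
    step : ∀ b → toℕ b ≡ suc (toℕ c) → φ-View c (0F ∷ b ∷ [])
    top  : toℕ c ≡ n → φ-View c (0F ∷ c ∷ c ∷ [])

  φ-view : ∀ c → φ-View c (φ n c)
  φ-view c with toℕ c <? n
  ... | yes c<n = step (fromℕ< (s≤s c<n)) (toℕ-fromℕ< (s≤s c<n))
  ... | no  c≮n = top (≤-antisym (toℕ≤pred[n] c) (≮⇒≥ c≮n))

  toℕ≡suc⇒≢0F : ∀ {b : Letter n} {m} → toℕ b ≡ suc m → b ≢ 0F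
  toℕ≡suc⇒≢0F b≡ refl = 0≢1+n b≡

  top⇒≢0F : ∀ {c : Letter n} → toℕ c ≡ n → c ≢ 0F
  top⇒≢0F c≡ refl = <-irrefl c≡ 0<n

  data Adjacent : Letter n → Letter n → Set where
    zero-nonzero : ∀ {b} → b ≢ 0F → Adjacent 0F b
    nonzero-zero : ∀ {c} → c ≢ 0F → Adjacent c 0F
    top-top      : ∀ {c} → toℕ c ≡ n → Adjacent c c

  linked-φ*    : ∀ y → Linked Adjacent (φ* n y)
  linked-≢0F∷φ* : ∀ {x} → x ≢ 0F → ∀ y → Linked Adjacent (x ∷ φ* n y)

  linked-φ* []      = []
  linked-φ* (c ∷ y) with φ n c | φ-view c
  ... | _ | step b b≡ = zero-nonzero (toℕ≡suc⇒≢0F b≡) ∷ linked-≢0F∷φ* (toℕ≡suc⇒≢0F b≡) y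
  ... | _ | top c≡    = zero-nonzero (top⇒≢0F c≡) ∷ top-top c≡ ∷ linked-≢0F∷φ* (top⇒≢0F c≡) y

  linked-≢0F∷φ* x≢0 []      = [-]
  linked-≢0F∷φ* x≢0 (c ∷ y) with φ n c | φ-view c | linked-φ* (c ∷ y)
  ... | _ | step _ _ | Rcy = nonzero-zero x≢0 ∷ Rcy
  ... | _ | top _    | Rcy = nonzero-zero x≢0 ∷ Rcy

  linked-iterate : ∀ m → Linked Adjacent (iterate n m)
  linked-iterate zero    = [-]
  linked-iterate (suc m) = linked-φ* (iterate n m)

  Factor : Word n → Word n → Set
  Factor x z = ∃₂ λ pre post → z ≡ pre ++ x ++ post

  Occurs : Word n → Set
  Occurs x = ∃ λ m → Factor x (iterate n m)

  occurs⇒linked : ∀ {x} → Occurs x → Linked Adjacent x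
  occurs⇒linked {x} (m , pre , post , e) =
    Linked-++⁻ˡ x (Linked-++⁻ʳ pre (subst (Linked Adjacent) e (linked-iterate m)))

  factor-++ʳ : ∀ {x z} s → Factor x z → Factor x (z ++ s)
  factor-++ʳ {x} {z} s (pre , post , z≡) = pre , post ++ s , (begin
    z ++ s                     ≡⟨ cong (_++ s) z≡ ⟩
    (pre ++ x ++ post) ++ s    ≡⟨ ++-assoc pre (x ++ post) s ⟩
    pre ++ (x ++ post) ++ s    ≡⟨ cong (pre ++_) (++-assoc x post s) ⟩
    pre ++ x ++ post ++ s      ∎)
    where open ≡-Reasoning

  iterate-prefix-suc : ∀ m → ∃ λ s → iterate n (suc m) ≡ iterate n m ++ s
  iterate-prefix-suc zero with φ n 0F | φ-view 0F
  ... | _ | step b _ = b ∷ [] , refl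
  ... | _ | top 0≡n  = ⊥-elim (top⇒≢0F 0≡n refl)
  iterate-prefix-suc (suc m) with s , e ← iterate-prefix-suc m =
    φ* n s , trans (cong (φ* n) e) (concatMap-++ (φ n) (iterate n m) s)

  iterate-prefix : ∀ {m} m′ → m ≤ m′ → ∃ λ s → iterate n m′ ≡ iterate n m ++ s
  iterate-prefix zero     z≤n  = [] , sym (++-identityʳ _)
  iterate-prefix (suc m′) m≤m′ with m≤n⇒m<n∨m≡n m≤m′
  ... | inj₂ refl = [] , sym (++-identityʳ _)
  ... | inj₁ m<1+m′ with s , e ← iterate-prefix m′ (s≤s⁻¹ m<1+m′) | t , e′ ← iterate-prefix-suc m′ =
    s ++ t , trans e′ (trans (cong (_++ t) e) (++-assoc _ s t))

  occurs-in-image : ∀ {x} → Occurs x → ∃ λ m → Factor x (φ* n (iterate n m))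
  occurs-in-image (m , x-factor) with s , e ← iterate-prefix-suc m =
    m , subst (Factor _) (sym e) (factor-++ʳ s x-factor)

  length-φ : ∀ c → 2 ≤ length (φ n c)
  length-φ c with φ n c | φ-view c
  ... | _ | step _ _ = s≤s (s≤s z≤n)
  ... | _ | top _    = s≤s (s≤s z≤n)

  length-φ* : ∀ y → length y + length y ≤ length (φ* n y)
  length-φ* []      = z≤n
  length-φ* (c ∷ y) = begin
    suc (length y + suc (length y))   ≡⟨ cong suc (+-suc (length y) (length y)) ⟩
    2 + (length y + length y)         ≤⟨ +-mono-≤ (length-φ c) (length-φ* y) ⟩
    length (φ n c) + length (φ* n y)  ≡⟨ length-++ (φ n c) ⟨
    length (φ* n (c ∷ y))             ∎
    where open ≤-Reasoning

  length-iterate : ∀ m → m < length (iterate n m)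
  length-iterate zero    = s≤s z≤n
  length-iterate (suc m) = begin-strict
    suc m          <⟨ s≤s (length-iterate m) ⟩
    suc L          ≤⟨ +-monoˡ-≤ L (≤-trans (s≤s z≤n) (length-iterate m)) ⟩
    L + L          ≤⟨ length-φ* (iterate n m) ⟩
    length (iterate n (suc m)) ∎
    where open ≤-Reasoning
          L = length (iterate n m)

  nth-++ : ∀ (x s : Word n) {p} → p < length x → nth (x ++ s) p ≡ nth x p
  nth-++ (c ∷ x) s {zero}  _         = refl
  nth-++ (c ∷ x) s {suc p} (s≤s p<x) = nth-++ x s p<x

  drop≡nth∷drop : ∀ (zs : Word n) {p} → p < length zs → drop p zs ≡ nth zs p ∷ drop (suc p) zs
  drop≡nth∷drop (c ∷ zs) {zero}  _          = refl
  drop≡nth∷drop (c ∷ zs) {suc p} (s≤s p<zs) = drop≡nth∷drop zs p<zs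

  u≡nth-iterate : ∀ {q N} → q < N → u n q ≡ nth (iterate n N) q
  u≡nth-iterate {q} {N} q<N with s , e ← iterate-prefix N q<N = sym (begin
    nth (iterate n N) q              ≡⟨ cong (λ z → nth z q) e ⟩
    nth (iterate n (suc q) ++ s) q   ≡⟨ nth-++ (iterate n (suc q)) s (<-trans (n<1+n q) (length-iterate (suc q))) ⟩
    u n q                            ∎)
    where open ≡-Reasoning

  factorAt-++-drop : ∀ N L p → p + L ≤ N →
    factorAt n p L ++ drop L (drop p (iterate n N)) ≡ drop p (iterate n N)
  factorAt-++-drop N zero    p _     = refl
  factorAt-++-drop N (suc L) p p+L≤N = begin
    u n p ∷ factorAt n (suc p) L ++ drop (suc L) (drop p zs)  ≡⟨ cong (λ t → u n p ∷ _ ++ drop (suc L) t) drop-p ⟩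
    u n p ∷ factorAt n (suc p) L ++ drop L (drop (suc p) zs)  ≡⟨ cong₂ _∷_ (u≡nth-iterate p<N) rest ⟩
    nth zs p ∷ drop (suc p) zs                                ≡⟨ drop-p ⟨
    drop p zs                                                 ∎
    where
    open ≡-Reasoning
    zs = iterate n N
    p<N = <-≤-trans (m<m+n p (s≤s z≤n)) p+L≤N
    drop-p = drop≡nth∷drop zs (<-trans p<N (length-iterate N))
    rest = factorAt-++-drop N L (suc p) (subst (_≤ N) (+-suc p L) p+L≤N)

  inLang⇒occurs : ∀ {x} → InLang n x → Occurs x
  inLang⇒occurs {x} (p , factor≡x) = N , take p zs , drop L (drop p zs) , (begin
    zs                                               ≡⟨ take++drop≡id p zs ⟨
    take p zs ++ drop p zs                           ≡⟨ cong (take p zs ++_) (factorAt-++-drop N L p ≤-refl) ⟨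
    take p zs ++ factorAt n p L ++ drop L (drop p zs) ≡⟨ cong (λ y → take p zs ++ y ++ drop L (drop p zs)) factor≡x ⟩
    take p zs ++ x ++ drop L (drop p zs)              ∎)
    where open ≡-Reasoning
          L = length x
          N = p + L
          zs = iterate n N

  φ*-head≡0F : ∀ y {x s} → φ* n y ≡ x ∷ s → x ≡ 0F
  φ*-head≡0F (c ∷ y) e with φ n c | φ-view c
  ... | _ | step _ _ = sym (∷-injectiveˡ e)
  ... | _ | top _    = sym (∷-injectiveˡ e)

  zero-starts-block : ∀ c q {r} → φ n c ≡ q ++ 0F ∷ r → q ≡ []
  zero-starts-block c q e with φ n c | φ-view c
  zero-starts-block c []                  _  | _ | _          = refl
  zero-starts-block c (_ ∷ [])            e  | _ | step _ b≡  = ⊥-elim (toℕ≡suc⇒≢0F b≡ (∷-injectiveˡ (∷-injectiveʳ e)))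
  zero-starts-block c (_ ∷ _ ∷ [])        () | _ | step _ _
  zero-starts-block c (_ ∷ _ ∷ _ ∷ _)     () | _ | step _ _
  zero-starts-block c (_ ∷ [])            e  | _ | top c≡n    = ⊥-elim (top⇒≢0F c≡n (∷-injectiveˡ (∷-injectiveʳ e)))
  zero-starts-block c (_ ∷ _ ∷ [])        e  | _ | top c≡n    = ⊥-elim (top⇒≢0F c≡n (∷-injectiveˡ (∷-injectiveʳ (∷-injectiveʳ e))))
  zero-starts-block c (_ ∷ _ ∷ _ ∷ [])    () | _ | top _
  zero-starts-block c (_ ∷ _ ∷ _ ∷ _ ∷ _) () | _ | top _

  below-top-in-block : ∀ c q {x r} → φ n c ≡ q ++ x ∷ r → x ≢ 0F → toℕ x < n → φ n c ≡ 0F ∷ x ∷ [] × r ≡ []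
  below-top-in-block c q e x≢0 x<n with φ n c | φ-view c
  below-top-in-block c []                  refl x≢0 _   | _ | step _ _ = ⊥-elim (x≢0 refl)
  below-top-in-block c []                  refl x≢0 _   | _ | top _    = ⊥-elim (x≢0 refl)
  below-top-in-block c (_ ∷ [])            refl _   _   | _ | step _ _ = refl , refl
  below-top-in-block c (_ ∷ _ ∷ [])        ()   _   _   | _ | step _ _
  below-top-in-block c (_ ∷ _ ∷ _ ∷ _)     ()   _   _   | _ | step _ _
  below-top-in-block c (_ ∷ [])            refl _   x<n | _ | top c≡n = ⊥-elim (<-irrefl c≡n x<n)
  below-top-in-block c (_ ∷ _ ∷ [])        refl _   x<n | _ | top c≡n = ⊥-elim (<-irrefl c≡n x<n)
  below-top-in-block c (_ ∷ _ ∷ _ ∷ [])    ()   _   _   | _ | top _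
  below-top-in-block c (_ ∷ _ ∷ _ ∷ _ ∷ _) ()   _   _   | _ | top _

  φ*-cut-at-zero : ∀ y {pre s} → φ* n y ≡ pre ++ 0F ∷ s →
    ∃₂ λ y₁ y₂ → y ≡ y₁ ++ y₂ × pre ≡ φ* n y₁ × φ* n y₂ ≡ 0F ∷ s
  φ*-cut-at-zero y e
    with located y₁ y₂ c q _ y≡ pre≡ φc≡ s≡ ← concatMap-locate (φ n) y e
    with refl ← zero-starts-block c q φc≡ =
    y₁ , c ∷ y₂ , y≡ , trans pre≡ (++-identityʳ _) , trans (cong (_++ φ* n y₂) φc≡) (cong (0F ∷_) (sym s≡))

  φ*-cut-below-top : ∀ y {pre x s} → φ* n y ≡ pre ++ x ∷ s → x ≢ 0F → toℕ x < n →
    ∃₂ λ y₁ c → ∃ λ y₂ → y ≡ y₁ ++ c ∷ y₂ × φ n c ≡ 0F ∷ x ∷ [] × s ≡ φ* n y₂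
  φ*-cut-below-top y e x≢0 x<n
    with located y₁ y₂ c q r y≡ _ φc≡ s≡ ← concatMap-locate (φ n) y e
    with φc≡0x , refl ← below-top-in-block c q φc≡ x≢0 x<n =
    y₁ , c , y₂ , y≡ , φc≡0x , s≡

  φ*-starting-0∷ : ∀ y {k s} → φ* n y ≡ 0F ∷ k ∷ s →
    ∃₂ λ k′ y′ → y ≡ k′ ∷ y′ × ∃ λ r → φ n k′ ≡ 0F ∷ k ∷ r
  φ*-starting-0∷ (c ∷ y) e with φ n c in φc≡ | φ-view c
  ... | _ | step b _ with refl ← ∷-injectiveˡ (∷-injectiveʳ e) = c , y , refl , [] , φc≡
  ... | _ | top _    with refl ← ∷-injectiveˡ (∷-injectiveʳ e) = c , y , refl , c ∷ [] , φc≡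

  φ*-injective : ∀ v v′ → φ* n v ≡ φ* n v′ → v ≡ v′
  φ*-injective []      []        _ = refl
  φ*-injective []      (c′ ∷ v′) e with φ n c′ | φ-view c′ | e
  ... | _ | step _ _ | ()
  ... | _ | top _    | ()
  φ*-injective (c ∷ v) []        e with φ n c | φ-view c | e
  ... | _ | step _ _ | ()
  ... | _ | top _    | ()
  φ*-injective (c ∷ v) (c′ ∷ v′) e with φ n c | φ-view c | φ n c′ | φ-view c′
  ... | _ | step b b≡ | _ | step _ b≡′ with refl , e′ ← ∷-injective (∷-injectiveʳ e) =
    cong₂ _∷_ (toℕ-injective (suc-injective (trans (sym b≡) b≡′))) (φ*-injective v v′ e′)
  ... | _ | top _ | _ | top _ with refl , e′ ← ∷-injective (∷-injectiveʳ e) =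
    cong (c ∷_) (φ*-injective v v′ (∷-injectiveʳ e′))
  ... | _ | step _ _ | _ | top c′≡n =
    ⊥-elim (top⇒≢0F c′≡n (φ*-head≡0F v (∷-injectiveʳ (∷-injectiveʳ e))))
  ... | _ | top c≡n | _ | step _ _ =
    ⊥-elim (top⇒≢0F c≡n (φ*-head≡0F v′ (sym (∷-injectiveʳ (∷-injectiveʳ e)))))

  record Desubstitution (i : Letter n) (w₀ : Word n) (k : Letter n) : Set where
    field
      i′ k′  : Letter n
      v      : Word n
      φ*v≡w₀ : φ* n v ≡ w₀
      occurs : Occurs (i′ ∷ v ++ k′ ∷ [])
      φi′≡   : φ n i′ ≡ 0F ∷ i ∷ []
      φk′≡   : ∃ λ r → φ n k′ ≡ 0F ∷ k ∷ r

  desubstitute : ∀ {i w₀ k} → Occurs (i ∷ w₀ ++ 0F ∷ k ∷ []) → i ≢ 0F → toℕ i < n → Desubstitution i w₀ k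
  desubstitute {i} {w₀} {k} occ i≢0 i<n
    with m , pre , post , e ← occurs-in-image occ
    with y₁ , i′ , y₂ , y≡ , φi′≡ , s≡ ← φ*-cut-below-top (iterate n m) e i≢0 i<n
    with v , y₃ , y₂≡ , w₀≡ , φ*y₃≡ ← φ*-cut-at-zero y₂ (trans (sym s≡) (++-assoc w₀ (0F ∷ k ∷ []) post))
    with k′ , y₄ , refl , φk′≡ ← φ*-starting-0∷ y₃ φ*y₃≡ = record
      { i′ = i′ ; k′ = k′ ; v = v ; φ*v≡w₀ = sym w₀≡ ; φi′≡ = φi′≡ ; φk′≡ = φk′≡
      ; occurs = m , y₁ , y₄ , trans y≡ (cong (λ t → y₁ ++ i′ ∷ t) (trans y₂≡ (sym (++-assoc v (k′ ∷ []) y₄))))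
      }

  second-letter≤suc : ∀ a {b r} → φ n a ≡ 0F ∷ b ∷ r → toℕ b ≤ suc (toℕ a)
  second-letter≤suc a e with φ n a | φ-view a
  second-letter≤suc a refl | _ | step _ b≡ = ≤-reflexive b≡
  second-letter≤suc a refl | _ | top _     = n≤1+n (toℕ a)

  second-letter≡suc : ∀ a {b} → φ n a ≡ 0F ∷ b ∷ [] → toℕ b ≡ suc (toℕ a)
  second-letter≡suc a e with φ n a | φ-view a
  second-letter≡suc a refl | _ | step _ b≡ = b≡
  second-letter≡suc a ()   | _ | top _

  distinct-second-letters⇒≢ : ∀ {a a′ b b′ r r′} → φ n a ≡ 0F ∷ b ∷ r → φ n a′ ≡ 0F ∷ b′ ∷ r′ → b ≢ b′ → a ≢ a′
  distinct-second-letters⇒≢ φa≡ φa′≡ b≢b′ refl = b≢b′ (∷-injectiveˡ (∷-injectiveʳ (trans (sym φa≡) φa′≡)))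

  ≢0F-mono : ∀ {a b : Letter n} → toℕ a ≤ toℕ b → a ≢ 0F → b ≢ 0F
  ≢0F-mono a≤b a≢0 refl = a≢0 (toℕ-injective (n≤0⇒n≡0 a≤b))

  below-top : ∀ {a k l : Letter n} → toℕ a ≤ toℕ k ⊓ toℕ l → k ≢ l → toℕ a < n
  below-top {a} {k} {l} a≤k⊓l k≢l = ≤∧≢⇒< (toℕ≤pred[n] a) λ a≡n →
    k≢l (toℕ-injective (trans (top-above (m≤n⊓o⇒m≤n _ _ a≤k⊓l) a≡n) (sym (top-above (m≤n⊓o⇒m≤o _ _ a≤k⊓l) a≡n))))
    where
    top-above : ∀ {x : Letter n} → toℕ a ≤ toℕ x → toℕ a ≡ n → toℕ x ≡ n
    top-above {x} a≤x a≡n = ≤-antisym (toℕ≤pred[n] x) (subst (_≤ toℕ x) a≡n a≤x)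

  weak-ascent⇒0F : ∀ {a b} → Adjacent a b → toℕ a < n → toℕ a ≤ toℕ b → a ≡ 0F
  weak-ascent⇒0F (zero-nonzero _)   _   _   = refl
  weak-ascent⇒0F (nonzero-zero a≢0) _   a≤0 = ⊥-elim (a≢0 (toℕ-injective (n≤0⇒n≡0 a≤0)))
  weak-ascent⇒0F (top-top a≡n)      a<n _   = ⊥-elim (<-irrefl a≡n a<n)

  distinct-predecessors⇒≢0F : ∀ {a b c} → Adjacent a c → Adjacent b c → toℕ b < n → a ≢ b → a ≢ 0F
  distinct-predecessors⇒≢0F (zero-nonzero _)   (zero-nonzero _) _   a≢b = a≢b
  distinct-predecessors⇒≢0F (zero-nonzero c≢0) (nonzero-zero _) _   _   _ = c≢0 refl
  distinct-predecessors⇒≢0F (zero-nonzero _)   (top-top b≡n)    b<n _   _ = <-irrefl b≡n b<n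
  distinct-predecessors⇒≢0F (nonzero-zero a≢0) _                _   _   = a≢0
  distinct-predecessors⇒≢0F (top-top a≡n)      _                _   _   = top⇒≢0F a≡n

  shared-predecessor≡0F : ∀ {c k l} → Adjacent c k → Adjacent c l → k ≢ 0F → l ≢ 0F → k ≢ l → c ≡ 0F
  shared-predecessor≡0F (zero-nonzero _) _                _   _   _   = refl
  shared-predecessor≡0F (nonzero-zero _) _                k≢0 _   _   = ⊥-elim (k≢0 refl)
  shared-predecessor≡0F (top-top _)      (zero-nonzero _) _   _   _   = refl
  shared-predecessor≡0F (top-top _)      (nonzero-zero _) _   l≢0 _   = ⊥-elim (l≢0 refl)
  shared-predecessor≡0F (top-top _)      (top-top _)      _   _   k≢l = ⊥-elim (k≢l refl)

  record Counterexample (w : Word n) : Set where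
    field
      i j k l   : Letter n
      i≢j       : i ≢ j
      k≢l       : k ≢ l
      separated : toℕ i ⊔ toℕ j ≤ toℕ k ⊓ toℕ l
      left      : Occurs (i ∷ w ++ k ∷ [])
      right     : Occurs (j ∷ w ++ l ∷ [])

    i≤k⊓l : toℕ i ≤ toℕ k ⊓ toℕ l
    i≤k⊓l = m⊔n≤o⇒m≤o (toℕ i) (toℕ j) separated

    j≤k⊓l : toℕ j ≤ toℕ k ⊓ toℕ l
    j≤k⊓l = m⊔n≤o⇒n≤o (toℕ i) (toℕ j) separated

    i≤k : toℕ i ≤ toℕ k
    i≤k = m≤n⊓o⇒m≤n (toℕ k) (toℕ l) i≤k⊓l

    j≤l : toℕ j ≤ toℕ l
    j≤l = m≤n⊓o⇒m≤o (toℕ k) (toℕ l) j≤k⊓l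

    i<n : toℕ i < n
    i<n = below-top i≤k⊓l k≢l

    j<n : toℕ j < n
    j<n = below-top j≤k⊓l k≢l

  ¬counterexample[] : ¬ Counterexample []
  ¬counterexample[] ce = i≢j (trans (weak-ascent⇒0F (Linked-head (occurs⇒linked left)) i<n i≤k)
                                 (sym (weak-ascent⇒0F (Linked-head (occurs⇒linked right)) j<n j≤l)))
    where open Counterexample ce

  first-letter≢0F : ∀ w₀ {i j c k l} → Linked Adjacent (i ∷ w₀ ++ c ∷ k ∷ []) →
    Linked Adjacent (j ∷ w₀ ++ c ∷ l ∷ []) → toℕ j < n → i ≢ j → i ≢ 0F
  first-letter≢0F []      (Aic ∷ _) (Ajc ∷ _) = distinct-predecessors⇒≢0F Aic Ajc
  first-letter≢0F (_ ∷ _) (Aib ∷ _) (Ajb ∷ _) = distinct-predecessors⇒≢0F Aib Ajb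

  descend : ∀ {i j k l w₀} → Desubstitution i w₀ k → Desubstitution j w₀ l → i ≢ j → k ≢ l →
    toℕ i ⊔ toℕ j ≤ toℕ k ⊓ toℕ l → ∃ λ v → length v ≤ length w₀ × Counterexample v
  descend {i} {j} {k} {l} {w₀} Dᵢ Dⱼ i≢j k≢l sep = Dᵢ.v , v≤w₀ , record
    { i = Dᵢ.i′ ; j = Dⱼ.i′ ; k = Dᵢ.k′ ; l = Dⱼ.k′
    ; i≢j = distinct-second-letters⇒≢ Dᵢ.φi′≡ Dⱼ.φi′≡ i≢j
    ; k≢l = distinct-second-letters⇒≢ (proj₂ Dᵢ.φk′≡) (proj₂ Dⱼ.φk′≡) k≢l
    ; separated = s≤s⁻¹ (begin
        suc (toℕ Dᵢ.i′ ⊔ toℕ Dⱼ.i′)  ≡⟨ cong₂ _⊔_ (second-letter≡suc _ Dᵢ.φi′≡) (second-letter≡suc _ Dⱼ.φi′≡) ⟨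
        toℕ i ⊔ toℕ j               ≤⟨ sep ⟩
        toℕ k ⊓ toℕ l               ≤⟨ ⊓-mono-≤ (second-letter≤suc _ (proj₂ Dᵢ.φk′≡)) (second-letter≤suc _ (proj₂ Dⱼ.φk′≡)) ⟩
        suc (toℕ Dᵢ.k′ ⊓ toℕ Dⱼ.k′)  ∎)
    ; left  = Dᵢ.occurs
    ; right = subst (λ t → Occurs (Dⱼ.i′ ∷ t ++ Dⱼ.k′ ∷ [])) v≡ Dⱼ.occurs
    }
    where
    module Dᵢ = Desubstitution Dᵢ
    module Dⱼ = Desubstitution Dⱼ
    open ≤-Reasoning
    v≡ : Dⱼ.v ≡ Dᵢ.v
    v≡ = φ*-injective Dⱼ.v Dᵢ.v (trans Dⱼ.φ*v≡w₀ (sym Dᵢ.φ*v≡w₀))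
    v≤w₀ : length Dᵢ.v ≤ length w₀
    v≤w₀ = subst (length Dᵢ.v ≤_) (cong length Dᵢ.φ*v≡w₀) (≤-trans (m≤m+n _ _) (length-φ* Dᵢ.v))

  shrink : ∀ w₀ {c} → Counterexample (w₀ ∷ʳ c) → ∃ λ v → length v ≤ length w₀ × Counterexample v
  shrink w₀ {c} ce =
    descend (desubstitute (at-zero occᵢ) i≢0F i<n) (desubstitute (at-zero occⱼ) j≢0F j<n) i≢j k≢l separated
    where
    open Counterexample ce
    occᵢ : Occurs (i ∷ w₀ ++ c ∷ k ∷ [])
    occᵢ = subst (λ t → Occurs (i ∷ t)) (∷ʳ-++ w₀ c (k ∷ [])) left
    occⱼ : Occurs (j ∷ w₀ ++ c ∷ l ∷ [])
    occⱼ = subst (λ t → Occurs (j ∷ t)) (∷ʳ-++ w₀ c (l ∷ [])) right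
    i≢0F : i ≢ 0F
    i≢0F = first-letter≢0F w₀ (occurs⇒linked occᵢ) (occurs⇒linked occⱼ) j<n i≢j
    j≢0F : j ≢ 0F
    j≢0F = first-letter≢0F w₀ (occurs⇒linked occⱼ) (occurs⇒linked occᵢ) i<n (i≢j ∘ sym)
    c≡0F : c ≡ 0F
    c≡0F = shared-predecessor≡0F (Linked-head (Linked-++⁻ʳ (i ∷ w₀) (occurs⇒linked occᵢ)))
                                 (Linked-head (Linked-++⁻ʳ (j ∷ w₀) (occurs⇒linked occⱼ)))
                                 (≢0F-mono i≤k i≢0F) (≢0F-mono j≤l j≢0F) k≢l
    at-zero : ∀ {a b} → Occurs (a ∷ w₀ ++ c ∷ b ∷ []) → Occurs (a ∷ w₀ ++ 0F ∷ b ∷ [])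
    at-zero {a} {b} = subst (λ t → Occurs (a ∷ w₀ ++ t ∷ b ∷ [])) c≡0F

  no-counterexample : ∀ w → Acc _<_ (length w) → ¬ Counterexample w
  no-counterexample w (acc rec) ce with initLast w
  ... | []       = ¬counterexample[] ce
  ... | w₀ ∷ʳ′ c =
    let v , v≤w₀ , ce′ = shrink w₀ ce in no-counterexample v (rec (≤-<-trans v≤w₀ w₀<w)) ce′
    where
    w₀<w : length w₀ < length (w₀ ∷ʳ c)
    w₀<w = subst (length w₀ <_) (sym (length-++ w₀)) (m<m+n (length w₀) (s≤s z≤n))

lemma3 : (n : ℕ) → 3 ≤ suc n → (i j k l : Letter n) → i ≢ j → k ≢ l →
         toℕ i ⊔ toℕ j ≤ toℕ k ⊓ toℕ l →
         ¬ (∃ λ (w : Word n) → InLang n (i ∷ w ++ k ∷ []) × InLang n (j ∷ w ++ l ∷ []))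
lemma3 n 3≤d i j k l i≢j k≢l separated (w , inᵢ , inⱼ) =
  no-counterexample n 0<n w (<-wellFounded (length w)) record
    { i = i ; j = j ; k = k ; l = l ; i≢j = i≢j ; k≢l = k≢l ; separated = separated
    ; left = inLang⇒occurs n 0<n inᵢ ; right = inLang⇒occurs n 0<n inⱼ }
  where
  0<n : 0 < n
  0<n = ≤-trans (s≤s z≤n) (s≤s⁻¹ 3≤d)
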